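{- Let $n\ge 2$, let $B$ be the random word in $\{\sigma,\mu,\lambda\}^{n-2}$ described in the context, and for a partitioning strategy $f$ let $A^f$ be the number of additional comparisons made by $f$ on $B$. Let $\mathrm{ct}$ be the strategy ``Count''. Then for every partitioning strategy $f$, $\mathbb{E}[A^{\mathrm{ct}}]\le\mathbb{E}[A^f]$.
   Context: Let $(a_1,\dots,a_n)$ be $n$ distinct elements in uniformly random order, $p=\min(a_1,a_n)$, $q=\max(a_1,a_n)$. The random word $B=(B_1,\dots,B_{n-2})$ has $B_t=\sigma$ if $a_{t+1}<p$, $B_t=\mu$ if $p<a_{t+1}<q$, and $B_t=\lambda$ if $a_{t+1}>q$. A partitioning strategy is a function $f\colon\{\sigma,\mu,\lambda\}^{<n-2}\to\{p,q\}$ (domain: words of length less than $n-2$). For a word $b$ write $b_{\le t}=(b_1,\dots,b_t)$. Strategy $f$ incurs an additional comparison in step $t+1$ ($0\le t<n-2$) on $b$ if $f(b_{\le t})=p$ and $b_{t+1}=\lambda$, or $f(b_{\le t})=q$ and $b_{t+1}=\sigma$; $A^f$ is the total number of such steps on $B$. Strategy ``Count'': $f^{\mathrm{ct}}(\tau)=p$ if $|\tau|_\sigma\ge|\tau|_\lambda$ and $q$ otherwise, where $|\tau|_\gamma$ denotes the number of occurrences of letter $\gamma$ in $\tau$. -}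

module Defs where

open import Data.Nat using (ℕ; zero; suc; _+_; _≤ᵇ_; _<ᵇ_; _⊓_; _⊔_)
open import Data.List using (List; []; _∷_; _++_; [_]; map; concatMap; upTo; length; filter)
open import Data.Nat.ListAction using (sum)
open import Data.Bool using (Bool; true; false; if_then_else_)

-- The three letters σ, μ, λ (λ is an Agda keyword, so it is written ℓ).
data Letter : Set where
  σ μ ℓ : Letter

data Pivot : Set where
  P Q : Pivot

-- A partitioning strategy: a function from words to pivots.
-- (Only its values on words of length < n-2 matter.)
Strategy : Set
Strategy = List Letter → Pivot

isσ isℓ : Letter → Bool
isσ σ = true
isσ _ = false
isℓ ℓ = true
isℓ _ = false

count-σ count-ℓ : List Letter → ℕ
count-σ [] = 0
count-σ (x ∷ xs) = (if isσ x then 1 else 0) + count-σ xs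
count-ℓ [] = 0
count-ℓ (x ∷ xs) = (if isℓ x then 1 else 0) + count-ℓ xs

countStrategy : Strategy
countStrategy τ = if count-ℓ τ ≤ᵇ count-σ τ then P else Q

stepCost : Pivot → Letter → ℕ
stepCost P ℓ = 1
stepCost Q σ = 1
stepCost _ _ = 0

addCmpFrom : Strategy → List Letter → List Letter → ℕ
addCmpFrom f pre [] = 0
addCmpFrom f pre (x ∷ xs) = stepCost (f pre) x + addCmpFrom f (pre ++ [ x ]) xs

addCmp : Strategy → List Letter → ℕ
addCmp f b = addCmpFrom f [] b

classify : ℕ → ℕ → ℕ → Letter
classify p q y = if y <ᵇ p then σ else (if y <ᵇ q then μ else ℓ)

lastOr : ℕ → List ℕ → ℕ
lastOr d [] = d
lastOr d (y ∷ ys) = lastOr y ys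

dropLast : List ℕ → List ℕ
dropLast [] = []
dropLast (y ∷ []) = []
dropLast (y ∷ z ∷ zs) = y ∷ dropLast (z ∷ zs)

-- The word B of an arrangement (a₁,…,aₙ): letters for a₂,…,a_{n-1}
-- with p = min(a₁,aₙ), q = max(a₁,aₙ).
wordOf : List ℕ → List Letter
wordOf [] = []
wordOf (x ∷ xs) = map (classify (x ⊓ lastOr x xs) (x ⊔ lastOr x xs)) (dropLast xs)

-- All permutations of a list (each ordering listed exactly once for distinct entries).
insertAll : ℕ → List ℕ → List (List ℕ)
insertAll x [] = [ x ∷ [] ]
insertAll x (y ∷ ys) = (x ∷ y ∷ ys) ∷ map (y ∷_) (insertAll x ys)

perms : List ℕ → List (List ℕ)
perms [] = [ [] ]
perms (x ∷ xs) = concatMap (insertAll x) (perms xs)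

-- n! · E[A^f] for the uniformly random order of the n distinct elements 0,…,n-1.
totalAddCmp : ℕ → Strategy → ℕ
totalAddCmp n f = sum (map (λ a → addCmp f (wordOf a)) (perms (upTo n)))

-- An arrangement has a given word with s σ's, m μ's and l λ's in exactly 2 · s! · m! · l! ways:
-- inserting the least element into an arrangement of the others either puts it strictly inside,
-- which inserts a σ into the word, or puts it at an end, which leaves a word around a single
-- pivot, and those words are counted in the same way. Hence n! · E[A^f] is a weighted sum over
-- words. After a prefix τ with |τ|_λ ≤ |τ|_σ, the continuations starting with λ weigh at most
-- as much as those starting with σ, so Count makes the cheapest choice in every step, and
-- backward induction over the remaining length shows that it is optimal overall.
module Submission where

open import Defs
open import Data.Nat using (ℕ; _≤_)
open import Data.Nat using (zero; suc; _+_; _*_; _!; s≤s; z≤n; _≤ᵇ_; _<ᵇ_; _⊓_; _⊔_)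
open import Data.Nat.Properties
open import Data.Nat.ListAction using (sum)
open import Data.Nat.ListAction.Properties using (sum-++)
open import Data.Nat.Solver using (module +-*-Solver)
open import Data.Bool using (Bool; true; false; if_then_else_; T)
open import Data.Unit using (tt)
open import Data.Sum using (inj₁; inj₂)
open import Data.List using (List; []; _∷_; _++_; _∷ʳ_; [_]; map; concatMap; upTo; length; replicate; initLast; _∷ʳ′_)
open import Data.List.Properties
  using (map-++; map-∘; map-cong; map-cong-local; length-map; map-applyUpTo; concatMap-map; concatMap-cong; map-concatMap; length-upTo)
open import Data.List.Relation.Unary.All as All using (All; []; _∷_)
open import Data.List.Relation.Unary.All.Properties using (map⁺; concat⁺)
open import Function using (_∘_)
open import Relation.Nullary.Negation using (contradiction)
open import Relation.Binary.PropositionalEquality hiding ([_])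
open +-*-Solver using (solve; _:+_; _:*_; _:=_; con)

sumMap : {A : Set} → List A → (A → ℕ) → ℕ
sumMap xs h = sum (map h xs)

sumMap-++ : {A : Set} (xs ys : List A) (h : A → ℕ) → sumMap (xs ++ ys) h ≡ sumMap xs h + sumMap ys h
sumMap-++ xs ys h = trans (cong sum (map-++ h xs ys)) (sum-++ (map h xs) (map h ys))

sumMap-concatMap : {A B : Set} (F : A → List B) (xs : List A) (h : B → ℕ) →
  sumMap (concatMap F xs) h ≡ sumMap xs (λ a → sumMap (F a) h)
sumMap-concatMap F [] h = refl
sumMap-concatMap F (x ∷ xs) h =
  trans (sumMap-++ (F x) (concatMap F xs) h) (cong (sumMap (F x) h +_) (sumMap-concatMap F xs h))

sumMap-+ : {A : Set} (xs : List A) (h₁ h₂ : A → ℕ) → sumMap xs (λ a → h₁ a + h₂ a) ≡ sumMap xs h₁ + sumMap xs h₂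
sumMap-+ [] h₁ h₂ = refl
sumMap-+ (x ∷ xs) h₁ h₂ = trans (cong (h₁ x + h₂ x +_) (sumMap-+ xs h₁ h₂))
  (solve 4 (λ a b c d → (a :+ b) :+ (c :+ d) := (a :+ c) :+ (b :+ d)) refl (h₁ x) (h₂ x) (sumMap xs h₁) (sumMap xs h₂))

sumMap-const : {A : Set} (xs : List A) (c : ℕ) → sumMap xs (λ _ → c) ≡ length xs * c
sumMap-const [] c = refl
sumMap-const (x ∷ xs) c = cong (c +_) (sumMap-const xs c)

-- Permutations

insertAll-map : ∀ (f : ℕ → ℕ) x ys → insertAll (f x) (map f ys) ≡ map (map f) (insertAll x ys)
insertAll-map f x [] = refl
insertAll-map f x (y ∷ ys) = cong ((f x ∷ f y ∷ map f ys) ∷_) (begin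
  map (f y ∷_) (insertAll (f x) (map f ys))    ≡⟨ cong (map (f y ∷_)) (insertAll-map f x ys) ⟩
  map (f y ∷_) (map (map f) (insertAll x ys))  ≡⟨ map-∘ (insertAll x ys) ⟨
  map (λ b → f y ∷ map f b) (insertAll x ys)   ≡⟨ map-∘ (insertAll x ys) ⟩
  map (map f) (map (y ∷_) (insertAll x ys))    ∎)
  where open ≡-Reasoning

perms-map : ∀ (f : ℕ → ℕ) xs → perms (map f xs) ≡ map (map f) (perms xs)
perms-map f [] = refl
perms-map f (x ∷ xs) = begin
  concatMap (insertAll (f x)) (perms (map f xs))           ≡⟨ cong (concatMap (insertAll (f x))) (perms-map f xs) ⟩
  concatMap (insertAll (f x)) (map (map f) (perms xs))     ≡⟨ concatMap-map (insertAll (f x)) (map f) (perms xs) ⟩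
  concatMap (λ a → insertAll (f x) (map f a)) (perms xs)   ≡⟨ concatMap-cong (insertAll-map f x) (perms xs) ⟩
  concatMap (λ a → map (map f) (insertAll x a)) (perms xs) ≡⟨ map-concatMap (map f) (insertAll x) (perms xs) ⟨
  map (map f) (concatMap (insertAll x) (perms xs))         ∎
  where open ≡-Reasoning

insertAll-∷ʳ : ∀ e ys z → insertAll e (ys ∷ʳ z) ≡ map (_∷ʳ z) (insertAll e ys) ++ [ ys ∷ʳ z ∷ʳ e ]
insertAll-∷ʳ e [] z = refl
insertAll-∷ʳ e (y ∷ ys) z = cong ((e ∷ y ∷ ys ∷ʳ z) ∷_) (begin
  map (y ∷_) (insertAll e (ys ∷ʳ z))                                   ≡⟨ cong (map (y ∷_)) (insertAll-∷ʳ e ys z) ⟩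
  map (y ∷_) (map (_∷ʳ z) (insertAll e ys) ++ [ ys ∷ʳ z ∷ʳ e ])       ≡⟨ map-++ (y ∷_) (map (_∷ʳ z) (insertAll e ys)) [ ys ∷ʳ z ∷ʳ e ] ⟩
  map (y ∷_) (map (_∷ʳ z) (insertAll e ys)) ++ [ y ∷ (ys ∷ʳ z ∷ʳ e) ] ≡⟨ cong (_++ [ y ∷ (ys ∷ʳ z ∷ʳ e) ]) (trans (sym (map-∘ (insertAll e ys))) (map-∘ (insertAll e ys))) ⟩
  map (_∷ʳ z) (map (y ∷_) (insertAll e ys)) ++ [ y ∷ (ys ∷ʳ z ∷ʳ e) ] ∎)
  where open ≡-Reasoning

insertAll-∷-∷ʳ : ∀ e x ys z → insertAll e (x ∷ (ys ∷ʳ z)) ≡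
  (e ∷ x ∷ (ys ∷ʳ z)) ∷ (map (λ b → x ∷ (b ∷ʳ z)) (insertAll e ys) ++ [ x ∷ (ys ∷ʳ z ∷ʳ e) ])
insertAll-∷-∷ʳ e x ys z = cong ((e ∷ x ∷ (ys ∷ʳ z)) ∷_)
  (trans (cong (map (x ∷_)) (insertAll-∷ʳ e ys z))
  (trans (map-++ (x ∷_) (map (_∷ʳ z) (insertAll e ys)) [ ys ∷ʳ z ∷ʳ e ])
         (cong (_++ [ x ∷ (ys ∷ʳ z ∷ʳ e) ]) (sym (map-∘ (insertAll e ys))))))

length-insertAll : ∀ x ys → length (insertAll x ys) ≡ suc (length ys)
length-insertAll x [] = refl
length-insertAll x (y ∷ ys) = cong suc (trans (length-map (y ∷_) (insertAll x ys)) (length-insertAll x ys))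

insertAll-lengths : ∀ x ys → All (λ b → length b ≡ suc (length ys)) (insertAll x ys)
insertAll-lengths x [] = refl ∷ []
insertAll-lengths x (y ∷ ys) = refl ∷ map⁺ (All.map (cong suc) (insertAll-lengths x ys))

perms-lengths : ∀ xs → All (λ a → length a ≡ length xs) (perms xs)
perms-lengths [] = refl ∷ []
perms-lengths (x ∷ xs) =
  concat⁺ (map⁺ (All.map (λ e → All.map (λ e′ → trans e′ (cong suc e)) (insertAll-lengths x _)) (perms-lengths xs)))

perms-upTo-lengths : ∀ n → All (λ a → length a ≡ n) (perms (upTo n))
perms-upTo-lengths n = All.map (λ e → trans e (length-upTo n)) (perms-lengths (upTo n))

sumPerms-const : ∀ xs c → sumMap (perms xs) (λ _ → c) ≡ length xs ! * c
sumPerms-const [] c = refl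
sumPerms-const (x ∷ xs) c = begin
  sumMap (concatMap (insertAll x) (perms xs)) (λ _ → c)     ≡⟨ sumMap-concatMap (insertAll x) (perms xs) _ ⟩
  sumMap (perms xs) (λ a → sumMap (insertAll x a) (λ _ → c)) ≡⟨ cong sum (map-cong-local (All.map (λ {a} → insertions a) (perms-lengths xs))) ⟩
  sumMap (perms xs) (λ _ → suc (length xs) * c)             ≡⟨ sumPerms-const xs _ ⟩
  length xs ! * (suc (length xs) * c)                       ≡⟨ solve 3 (λ f s c → f :* (s :* c) := s :* f :* c) refl (length xs !) (suc (length xs)) c ⟩
  suc (length xs) ! * c                                     ∎
  where
  open ≡-Reasoning
  insertions : ∀ a → length a ≡ length xs → sumMap (insertAll x a) (λ _ → c) ≡ suc (length xs) * c
  insertions a e = trans (sumMap-const (insertAll x a) c) (cong (_* c) (trans (length-insertAll x a) (cong suc e)))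

sumPerms-upTo-suc : ∀ n (h : List ℕ → ℕ) →
  sumMap (perms (upTo (suc n))) h ≡ sumMap (perms (upTo n)) (λ a → sumMap (insertAll 0 (map suc a)) h)
sumPerms-upTo-suc n h = begin
  sumMap (perms (upTo (suc n))) h                                         ≡⟨ cong (λ l → sumMap (perms (0 ∷ l)) h) (map-applyUpTo (λ x → x) suc n) ⟨
  sumMap (perms (0 ∷ map suc (upTo n))) h                                 ≡⟨ sumMap-concatMap (insertAll 0) (perms (map suc (upTo n))) h ⟩
  sumMap (perms (map suc (upTo n))) (λ a → sumMap (insertAll 0 a) h)        ≡⟨ cong (λ Ps → sumMap Ps (λ a → sumMap (insertAll 0 a) h)) (perms-map suc (upTo n)) ⟩
  sumMap (map (map suc) (perms (upTo n))) (λ a → sumMap (insertAll 0 a) h) ≡⟨ cong sum (map-∘ (perms (upTo n))) ⟨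
  sumMap (perms (upTo n)) (λ a → sumMap (insertAll 0 (map suc a)) h)        ∎
  where open ≡-Reasoning

-- Sums over words

sumLetters : (Letter → ℕ) → ℕ
sumLetters F = F σ + (F μ + F ℓ)

sumLetters-cong : ∀ {F G : Letter → ℕ} → (∀ x → F x ≡ G x) → sumLetters F ≡ sumLetters G
sumLetters-cong e = cong₂ _+_ (e σ) (cong₂ _+_ (e μ) (e ℓ))

sumLetters-+ : ∀ (F G : Letter → ℕ) → sumLetters (λ x → F x + G x) ≡ sumLetters F + sumLetters G
sumLetters-+ F G = solve 6 (λ a b c d e f → (a :+ d) :+ ((b :+ e) :+ (c :+ f)) := (a :+ (b :+ c)) :+ (d :+ (e :+ f)))
  refl (F σ) (F μ) (F ℓ) (G σ) (G μ) (G ℓ)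

sumLetters-* : ∀ s (F : Letter → ℕ) → sumLetters (λ x → s * F x) ≡ s * sumLetters F
sumLetters-* s F = sym (trans (*-distribˡ-+ s (F σ) _) (cong (s * F σ +_) (*-distribˡ-+ s (F μ) (F ℓ))))

sumLetters-mono-≤ : ∀ {F G : Letter → ℕ} → (∀ x → F x ≤ G x) → sumLetters F ≤ sumLetters G
sumLetters-mono-≤ h = +-mono-≤ (h σ) (+-mono-≤ (h μ) (h ℓ))

sumWords : ℕ → (List Letter → ℕ) → ℕ
sumWords zero h = h []
sumWords (suc k) h = sumLetters (λ x → sumWords k (λ w → h (x ∷ w)))

sumWords-cong : ∀ k {h₁ h₂ : List Letter → ℕ} → (∀ w → h₁ w ≡ h₂ w) → sumWords k h₁ ≡ sumWords k h₂
sumWords-cong zero e = e []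
sumWords-cong (suc k) e = sumLetters-cong (λ x → sumWords-cong k (λ w → e (x ∷ w)))

sumWords-+ : ∀ k (h₁ h₂ : List Letter → ℕ) → sumWords k (λ w → h₁ w + h₂ w) ≡ sumWords k h₁ + sumWords k h₂
sumWords-+ zero h₁ h₂ = refl
sumWords-+ (suc k) h₁ h₂ =
  trans (sumLetters-cong (λ x → sumWords-+ k (λ w → h₁ (x ∷ w)) (λ w → h₂ (x ∷ w)))) (sumLetters-+ (λ x → sumWords k (λ w → h₁ (x ∷ w))) (λ x → sumWords k (λ w → h₂ (x ∷ w))))

sumWords-* : ∀ k s (h : List Letter → ℕ) → sumWords k (λ w → s * h w) ≡ s * sumWords k h
sumWords-* zero s h = refl
sumWords-* (suc k) s h = trans (sumLetters-cong (λ x → sumWords-* k s (λ w → h (x ∷ w)))) (sumLetters-* s (λ x → sumWords k (λ w → h (x ∷ w))))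

sumWords-0 : ∀ k → sumWords k (λ _ → 0) ≡ 0
sumWords-0 zero = refl
sumWords-0 (suc k) rewrite sumWords-0 k = refl

sumWords-distribˡ : ∀ k (p q r : List Letter → ℕ) →
  sumWords k (λ w → p w * (q w + r w)) ≡ sumWords k (λ w → p w * q w) + sumWords k (λ w → p w * r w)
sumWords-distribˡ k p q r = trans (sumWords-cong k (λ w → *-distribˡ-+ (p w) (q w) (r w))) (sumWords-+ k (λ w → p w * q w) (λ w → p w * r w))

sumWords-distribʳ : ∀ k (p q r : List Letter → ℕ) →
  sumWords k (λ w → (p w + q w) * r w) ≡ sumWords k (λ w → p w * r w) + sumWords k (λ w → q w * r w)
sumWords-distribʳ k p q r = trans (sumWords-cong k (λ w → *-distribʳ-+ (r w) (p w) (q w))) (sumWords-+ k (λ w → p w * r w) (λ w → q w * r w))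

sameLetter : Letter → Letter → Bool
sameLetter σ σ = true
sameLetter μ μ = true
sameLetter ℓ ℓ = true
sameLetter _ _ = false

sumInserting : Letter → (List Letter → ℕ) → List Letter → ℕ
sumInserting x g [] = g [ x ]
sumInserting x g (y ∷ w) = g (x ∷ y ∷ w) + sumInserting x (λ u → g (y ∷ u)) w

sumDeleting : Letter → (List Letter → ℕ) → List Letter → ℕ
sumDeleting x φ [] = 0
sumDeleting x φ (y ∷ v) = (if sameLetter x y then φ v else 0) + sumDeleting x (λ w → φ (y ∷ w)) v

sumDeleting-0 : ∀ x v → sumDeleting x (λ _ → 0) v ≡ 0
sumDeleting-0 x [] = refl
sumDeleting-0 x (y ∷ v) with sameLetter x y
... | true = sumDeleting-0 x v
... | false = sumDeleting-0 x v

sumLetters-sameLetter : ∀ k x (φ g : List Letter → ℕ) →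
  sumLetters (λ y → sumWords k (λ v → (if sameLetter x y then φ v else 0) * g (y ∷ v))) ≡ sumWords k (λ v → φ v * g (x ∷ v))
sumLetters-sameLetter k σ φ g rewrite sumWords-0 k = +-identityʳ _
sumLetters-sameLetter k μ φ g rewrite sumWords-0 k = +-identityʳ _
sumLetters-sameLetter k ℓ φ g rewrite sumWords-0 k = refl

sumWords-sumDeleting : ∀ k x (φ g : List Letter → ℕ) →
  sumWords (suc k) (λ u → sumDeleting x φ u * g u) ≡
  sumWords k (λ v → φ v * g (x ∷ v)) + sumLetters (λ y → sumWords k (λ v → sumDeleting x (λ w → φ (y ∷ w)) v * g (y ∷ v)))
sumWords-sumDeleting k x φ g =
  trans (sumLetters-cong (λ y → sumWords-distribʳ k (λ v → if sameLetter x y then φ v else 0) (Φ y) (λ v → g (y ∷ v))))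
  (trans (sumLetters-+ (λ y → sumWords k (λ v → (if sameLetter x y then φ v else 0) * g (y ∷ v))) rest)
         (cong (_+ sumLetters rest) (sumLetters-sameLetter k x φ g)))
  where
  Φ : Letter → List Letter → ℕ
  Φ y = sumDeleting x (λ w → φ (y ∷ w))
  rest : Letter → ℕ
  rest y = sumWords k (λ v → Φ y v * g (y ∷ v))

-- Double counting of the pairs (w, position) ↔ (u, occurrence of x in u), where u is w with x inserted.
sumWords-sumInserting : ∀ k x (φ g : List Letter → ℕ) →
  sumWords k (λ w → φ w * sumInserting x g w) ≡ sumWords (suc k) (λ u → sumDeleting x φ u * g u)
sumWords-sumInserting zero x φ g = sym (trans (sumWords-sumDeleting zero x φ g) (+-identityʳ _))
sumWords-sumInserting (suc k) x φ g =
  trans (sumLetters-cong (λ y → trans (sumWords-distribˡ k (λ w → φ (y ∷ w)) (λ w → g (x ∷ y ∷ w)) (λ w → sumInserting x (λ u → g (y ∷ u)) w))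
                                       (cong (here y +_) (sumWords-sumInserting k x (λ w → φ (y ∷ w)) (λ u → g (y ∷ u))))))
  (trans (sumLetters-+ here rest)
         (sym (sumWords-sumDeleting (suc k) x φ g)))
  where
  here rest : Letter → ℕ
  here y = sumWords k (λ w → φ (y ∷ w) * g (x ∷ y ∷ w))
  rest y = sumWords (suc k) (λ v → sumDeleting x (λ w → φ (y ∷ w)) v * g (y ∷ v))

-- weight a m c w = (a + |w|σ)! (m + |w|μ)! (c + |w|λ)!; for a = m = c = 0 it is half the number
-- of arrangements with word w (sumPerms-wordOf).
weight : ℕ → ℕ → ℕ → List Letter → ℕ
weight a m c [] = a ! * m ! * c !
weight a m c (σ ∷ w) = weight (suc a) m c w
weight a m c (μ ∷ w) = weight a (suc m) c w
weight a m c (ℓ ∷ w) = weight a m (suc c) w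

weightNoσ : ℕ → ℕ → List Letter → ℕ
weightNoσ m c [] = m ! * c !
weightNoσ m c (σ ∷ w) = 0
weightNoσ m c (μ ∷ w) = weightNoσ (suc m) c w
weightNoσ m c (ℓ ∷ w) = weightNoσ m (suc c) w

weightOnlyℓ : ℕ → List Letter → ℕ
weightOnlyℓ c [] = c !
weightOnlyℓ c (σ ∷ w) = 0
weightOnlyℓ c (μ ∷ w) = 0
weightOnlyℓ c (ℓ ∷ w) = weightOnlyℓ (suc c) w

-- s · (a + s)! + (a + 1) · (a + s)! = (a + s + 1)!, where s is the number of σ's in u.
sumDeleting-σ-weight : ∀ u a m c → sumDeleting σ (weight (suc a) m c) u + suc a * weight a m c u ≡ weight (suc a) m c u
sumDeleting-σ-weight [] a m c = solve 4 (λ s x y z → s :* (x :* y :* z) := s :* x :* y :* z) refl (suc a) (a !) (m !) (c !)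
sumDeleting-σ-weight (σ ∷ v) a m c =
  trans (solve 3 (λ W D s → (W :+ D) :+ s :* W := D :+ (W :+ s :* W)) refl (weight (suc a) m c v) (sumDeleting σ (weight (suc (suc a)) m c) v) (suc a))
        (sumDeleting-σ-weight v (suc a) m c)
sumDeleting-σ-weight (μ ∷ v) a m c = sumDeleting-σ-weight v a (suc m) c
sumDeleting-σ-weight (ℓ ∷ v) a m c = sumDeleting-σ-weight v a m (suc c)

sumDeleting-σ-weight₀ : ∀ u m c → sumDeleting σ (weight 0 m c) u + weightNoσ m c u ≡ weight 0 m c u
sumDeleting-σ-weight₀ [] m c = solve 2 (λ x y → x :* y := con 1 :* x :* y) refl (m !) (c !)
sumDeleting-σ-weight₀ (σ ∷ v) m c =
  trans (solve 2 (λ W D → (W :+ D) :+ con 0 := D :+ con 1 :* W) refl (weight 0 m c v) (sumDeleting σ (weight 1 m c) v))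
        (sumDeleting-σ-weight v 0 m c)
sumDeleting-σ-weight₀ (μ ∷ v) m c = sumDeleting-σ-weight₀ v (suc m) c
sumDeleting-σ-weight₀ (ℓ ∷ v) m c = sumDeleting-σ-weight₀ v m (suc c)

sumDeleting-μ-weightNoσ : ∀ u m c → sumDeleting μ (weightNoσ (suc m) c) u + suc m * weightNoσ m c u ≡ weightNoσ (suc m) c u
sumDeleting-μ-weightNoσ [] m c = solve 3 (λ s x z → s :* (x :* z) := s :* x :* z) refl (suc m) (m !) (c !)
sumDeleting-μ-weightNoσ (σ ∷ v) m c rewrite sumDeleting-0 μ v = *-zeroʳ m
sumDeleting-μ-weightNoσ (μ ∷ v) m c =
  trans (solve 3 (λ W D s → (W :+ D) :+ s :* W := D :+ (W :+ s :* W)) refl (weightNoσ (suc m) c v) (sumDeleting μ (weightNoσ (suc (suc m)) c) v) (suc m))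
        (sumDeleting-μ-weightNoσ v (suc m) c)
sumDeleting-μ-weightNoσ (ℓ ∷ v) m c = sumDeleting-μ-weightNoσ v m (suc c)

sumDeleting-μ-weightNoσ₀ : ∀ u c → sumDeleting μ (weightNoσ 0 c) u + weightOnlyℓ c u ≡ weightNoσ 0 c u
sumDeleting-μ-weightNoσ₀ [] c = sym (+-identityʳ (c !))
sumDeleting-μ-weightNoσ₀ (σ ∷ v) c rewrite sumDeleting-0 μ v = refl
sumDeleting-μ-weightNoσ₀ (μ ∷ v) c =
  trans (solve 2 (λ W D → (W :+ D) :+ con 0 := D :+ con 1 :* W) refl (weightNoσ 0 c v) (sumDeleting μ (weightNoσ 1 c) v))
        (sumDeleting-μ-weightNoσ v 0 c)
sumDeleting-μ-weightNoσ₀ (ℓ ∷ v) c = sumDeleting-μ-weightNoσ₀ v (suc c)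

sumWords-weightOnlyℓ : ∀ k c (g : List Letter → ℕ) → sumWords k (λ w → weightOnlyℓ c w * g w) ≡ (c + k) ! * g (replicate k ℓ)
sumWords-weightOnlyℓ zero c g rewrite +-identityʳ c = refl
sumWords-weightOnlyℓ (suc k) c g rewrite sumWords-0 k | +-suc c k = sumWords-weightOnlyℓ k (suc c) (λ w → g (ℓ ∷ w))

sumWords-weightNoσ-suc : ∀ k (g : List Letter → ℕ) →
  suc k ! * g (replicate (suc k) ℓ) + sumWords k (λ w → weightNoσ 0 0 w * sumInserting μ g w) ≡ sumWords (suc k) (λ w → weightNoσ 0 0 w * g w)
sumWords-weightNoσ-suc k g = begin
  suc k ! * g (replicate (suc k) ℓ) + sumWords k (λ w → weightNoσ 0 0 w * sumInserting μ g w)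
    ≡⟨ cong₂ _+_ (sym (sumWords-weightOnlyℓ (suc k) 0 g)) (sumWords-sumInserting k μ (weightNoσ 0 0) g) ⟩
  sumWords (suc k) (λ u → weightOnlyℓ 0 u * g u) + sumWords (suc k) (λ u → sumDeleting μ (weightNoσ 0 0) u * g u)
    ≡⟨ sumWords-distribʳ (suc k) (weightOnlyℓ 0) (sumDeleting μ (weightNoσ 0 0)) g ⟨
  sumWords (suc k) (λ u → (weightOnlyℓ 0 u + sumDeleting μ (weightNoσ 0 0) u) * g u)
    ≡⟨ sumWords-cong (suc k) (λ u → cong (_* g u) (trans (+-comm (weightOnlyℓ 0 u) _) (sumDeleting-μ-weightNoσ₀ u 0))) ⟩
  sumWords (suc k) (λ w → weightNoσ 0 0 w * g w) ∎
  where open ≡-Reasoning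

sumWords-weight-suc : ∀ k (g : List Letter → ℕ) →
  sumWords (suc k) (λ w → weightNoσ 0 0 w * g w) + sumWords k (λ w → weight 0 0 0 w * sumInserting σ g w) ≡ sumWords (suc k) (λ w → weight 0 0 0 w * g w)
sumWords-weight-suc k g = begin
  sumWords (suc k) (λ w → weightNoσ 0 0 w * g w) + sumWords k (λ w → weight 0 0 0 w * sumInserting σ g w)
    ≡⟨ cong (sumWords (suc k) (λ w → weightNoσ 0 0 w * g w) +_) (sumWords-sumInserting k σ (weight 0 0 0) g) ⟩
  sumWords (suc k) (λ u → weightNoσ 0 0 u * g u) + sumWords (suc k) (λ u → sumDeleting σ (weight 0 0 0) u * g u)
    ≡⟨ sumWords-distribʳ (suc k) (weightNoσ 0 0) (sumDeleting σ (weight 0 0 0)) g ⟨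
  sumWords (suc k) (λ u → (weightNoσ 0 0 u + sumDeleting σ (weight 0 0 0) u) * g u)
    ≡⟨ sumWords-cong (suc k) (λ u → cong (_* g u) (trans (+-comm (weightNoσ 0 0 u) _) (sumDeleting-σ-weight₀ u 0 0))) ⟩
  sumWords (suc k) (λ w → weight 0 0 0 w * g w) ∎
  where open ≡-Reasoning

-- Counting arrangements by their word

sideOf : ℕ → ℕ → Letter
sideOf z y = if y <ᵇ z then μ else ℓ

-- The words of the partitions around the single pivot given by the first, resp. last, element:
-- μ below the pivot, λ above it.
firstPivotWord : List ℕ → List Letter
firstPivotWord [] = []
firstPivotWord (x ∷ r) = map (sideOf x) r

lastPivotWord : List ℕ → List Letter
lastPivotWord l = map (sideOf (lastOr 0 l)) (dropLast l)

map-sideOf-0 : ∀ l → map (sideOf 0) l ≡ replicate (length l) ℓ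
map-sideOf-0 [] = refl
map-sideOf-0 (y ∷ l) = cong (ℓ ∷_) (map-sideOf-0 l)

lastOr-∷ʳ : ∀ d ys z → lastOr d (ys ∷ʳ z) ≡ z
lastOr-∷ʳ d [] z = refl
lastOr-∷ʳ d (y ∷ ys) z = lastOr-∷ʳ y ys z

dropLast-∷ʳ : ∀ ys z → dropLast (ys ∷ʳ z) ≡ ys
dropLast-∷ʳ [] z = refl
dropLast-∷ʳ (y ∷ []) z = refl
dropLast-∷ʳ (y ∷ y′ ∷ ys) z = cong (y ∷_) (dropLast-∷ʳ (y′ ∷ ys) z)

lastPivotWord-∷ʳ : ∀ ys z → lastPivotWord (ys ∷ʳ z) ≡ map (sideOf z) ys
lastPivotWord-∷ʳ ys z rewrite lastOr-∷ʳ 0 ys z | dropLast-∷ʳ ys z = refl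

wordOf-∷ʳ : ∀ x ys z → wordOf (x ∷ (ys ∷ʳ z)) ≡ map (classify (x ⊓ z) (x ⊔ z)) ys
wordOf-∷ʳ x ys z rewrite lastOr-∷ʳ x ys z | dropLast-∷ʳ ys z = refl

sumMap-insertAll-map : ∀ (C : ℕ → Letter) (g : List Letter → ℕ) e l →
  sumMap (insertAll e l) (λ b → g (map C b)) ≡ sumInserting (C e) g (map C l)
sumMap-insertAll-map C g e [] = +-identityʳ _
sumMap-insertAll-map C g e (y ∷ r) = cong (g (C e ∷ C y ∷ map C r) +_)
  (trans (cong sum (sym (map-∘ (insertAll e r)))) (sumMap-insertAll-map C (λ u → g (C y ∷ u)) e r))

-- Inserting a new least element 0 either makes it the pivot, so that every other element is
-- above it, or inserts a μ into the word.
firstPivotWord-insert : ∀ (g : List Letter → ℕ) a {k} → length a ≡ suc k →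
  sumMap (insertAll 0 (map suc a)) (g ∘ firstPivotWord) ≡ g (replicate (suc k) ℓ) + sumInserting μ g (firstPivotWord a)
firstPivotWord-insert g (x ∷ r) e = cong₂ _+_
  (cong g (trans (map-sideOf-0 (suc x ∷ map suc r)) (cong (λ n → replicate n ℓ) (trans (cong suc (length-map suc r)) e))))
  (trans (cong sum (sym (map-∘ (insertAll 0 (map suc r)))))
  (trans (sumMap-insertAll-map (sideOf (suc x)) g 0 (map suc r))
         (cong (sumInserting μ g) (sym (map-∘ r)))))

lastPivotWord-insert : ∀ (g : List Letter → ℕ) a {k} → length a ≡ suc k →
  sumMap (insertAll 0 (map suc a)) (g ∘ lastPivotWord) ≡ g (replicate (suc k) ℓ) + sumInserting μ g (lastPivotWord a)
lastPivotWord-insert g a {k} e with initLast a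
... | [] = contradiction e λ ()
... | ys ∷ʳ′ z = begin
  sumMap (insertAll 0 (map suc (ys ∷ʳ z))) (g ∘ lastPivotWord)
    ≡⟨ cong (λ l → sumMap (insertAll 0 l) (g ∘ lastPivotWord)) (map-++ suc ys [ z ]) ⟩
  sumMap (insertAll 0 (map suc ys ∷ʳ suc z)) (g ∘ lastPivotWord)
    ≡⟨ cong (λ L → sumMap L (g ∘ lastPivotWord)) (insertAll-∷ʳ 0 (map suc ys) (suc z)) ⟩
  sumMap (map (_∷ʳ suc z) I ++ [ map suc ys ∷ʳ suc z ∷ʳ 0 ]) (g ∘ lastPivotWord)
    ≡⟨ sumMap-++ (map (_∷ʳ suc z) I) _ (g ∘ lastPivotWord) ⟩
  sumMap (map (_∷ʳ suc z) I) (g ∘ lastPivotWord) + (g (lastPivotWord (map suc ys ∷ʳ suc z ∷ʳ 0)) + 0)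
    ≡⟨ cong₂ _+_ inside (trans (+-identityʳ _) (cong g back)) ⟩
  sumInserting μ g (lastPivotWord (ys ∷ʳ z)) + g (replicate (suc k) ℓ)
    ≡⟨ +-comm (sumInserting μ g (lastPivotWord (ys ∷ʳ z))) _ ⟩
  g (replicate (suc k) ℓ) + sumInserting μ g (lastPivotWord (ys ∷ʳ z)) ∎
  where
  open ≡-Reasoning
  I : List (List ℕ)
  I = insertAll 0 (map suc ys)
  inside : sumMap (map (_∷ʳ suc z) I) (g ∘ lastPivotWord) ≡ sumInserting μ g (lastPivotWord (ys ∷ʳ z))
  inside =
    trans (cong sum (sym (map-∘ I)))
    (trans (cong sum (map-cong (λ b → cong g (lastPivotWord-∷ʳ b (suc z))) I))
    (trans (sumMap-insertAll-map (sideOf (suc z)) g 0 (map suc ys))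
           (cong (sumInserting μ g) (trans (sym (map-∘ ys)) (sym (lastPivotWord-∷ʳ ys z))))))
  back : lastPivotWord (map suc ys ∷ʳ suc z ∷ʳ 0) ≡ replicate (suc k) ℓ
  back =
    trans (lastPivotWord-∷ʳ (map suc ys ∷ʳ suc z) 0)
    (trans (cong (map (sideOf 0)) (sym (map-++ suc ys [ z ])))
    (trans (map-sideOf-0 (map suc (ys ∷ʳ z)))
           (cong (λ n → replicate n ℓ) (trans (length-map suc (ys ∷ʳ z)) e))))

-- Inserting 0 in front gives the last pivot word, inserting it at the back gives the first pivot word,
-- and inserting it strictly inside inserts a σ into the word.
wordOf-insert : ∀ (g : List Letter → ℕ) a {m} → length a ≡ suc (suc m) →
  sumMap (insertAll 0 (map suc a)) (g ∘ wordOf) ≡ g (lastPivotWord a) + (sumInserting σ g (wordOf a) + g (firstPivotWord a))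
wordOf-insert g (x ∷ a) e with initLast a
... | [] = contradiction e λ ()
... | mid ∷ʳ′ z = begin
  sumMap (insertAll 0 (map suc (x ∷ (mid ∷ʳ z)))) (g ∘ wordOf)
    ≡⟨ cong (λ l → sumMap (insertAll 0 (suc x ∷ l)) (g ∘ wordOf)) (map-++ suc mid [ z ]) ⟩
  sumMap (insertAll 0 (suc x ∷ (map suc mid ∷ʳ suc z))) (g ∘ wordOf)
    ≡⟨ cong (λ L → sumMap L (g ∘ wordOf)) (insertAll-∷-∷ʳ 0 (suc x) (map suc mid) (suc z)) ⟩
  g (wordOf (0 ∷ suc x ∷ (map suc mid ∷ʳ suc z))) + sumMap (map inside I ++ [ last ]) (g ∘ wordOf)
    ≡⟨ cong (g (wordOf (0 ∷ suc x ∷ (map suc mid ∷ʳ suc z))) +_) (sumMap-++ (map inside I) [ last ] (g ∘ wordOf)) ⟩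
  g (wordOf (0 ∷ suc x ∷ (map suc mid ∷ʳ suc z))) + (sumMap (map inside I) (g ∘ wordOf) + (g (wordOf last) + 0))
    ≡⟨ cong₂ _+_ (cong g front) (cong₂ _+_ middle (trans (+-identityʳ _) (cong g back))) ⟩
  g (lastPivotWord (x ∷ (mid ∷ʳ z))) + (sumInserting σ g (wordOf (x ∷ (mid ∷ʳ z))) + g (firstPivotWord (x ∷ (mid ∷ʳ z)))) ∎
  where
  open ≡-Reasoning
  I : List (List ℕ)
  I = insertAll 0 (map suc mid)
  inside : List ℕ → List ℕ
  inside b = suc x ∷ (b ∷ʳ suc z)
  last : List ℕ
  last = suc x ∷ (map suc mid ∷ʳ suc z ∷ʳ 0)
  front : wordOf (0 ∷ suc x ∷ (map suc mid ∷ʳ suc z)) ≡ lastPivotWord (x ∷ (mid ∷ʳ z))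
  front = trans (wordOf-∷ʳ 0 (suc x ∷ map suc mid) (suc z)) (trans (sym (map-∘ (x ∷ mid))) (sym (lastPivotWord-∷ʳ (x ∷ mid) z)))
  middle : sumMap (map inside I) (g ∘ wordOf) ≡ sumInserting σ g (wordOf (x ∷ (mid ∷ʳ z)))
  middle =
    trans (cong sum (sym (map-∘ I)))
    (trans (cong sum (map-cong (λ b → cong g (wordOf-∷ʳ (suc x) b (suc z))) I))
    (trans (sumMap-insertAll-map (classify (suc (x ⊓ z)) (suc (x ⊔ z))) g 0 (map suc mid))
           (cong (sumInserting σ g) (trans (sym (map-∘ mid)) (sym (wordOf-∷ʳ x mid z))))))
  back : wordOf last ≡ firstPivotWord (x ∷ (mid ∷ʳ z))
  back =
    trans (wordOf-∷ʳ (suc x) (map suc mid ∷ʳ suc z) 0)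
    (trans (cong (map (classify 0 (suc x))) (sym (map-++ suc mid [ z ])))
           (sym (map-∘ (mid ∷ʳ z))))

sumPerms-pivotWord : (G : List ℕ → List Letter) → G [ 0 ] ≡ [] →
  (∀ (g : List Letter → ℕ) a {k} → length a ≡ suc k →
     sumMap (insertAll 0 (map suc a)) (g ∘ G) ≡ g (replicate (suc k) ℓ) + sumInserting μ g (G a)) →
  ∀ k (g : List Letter → ℕ) → sumMap (perms (upTo (suc k))) (g ∘ G) ≡ sumWords k (λ w → weightNoσ 0 0 w * g w)
sumPerms-pivotWord G G[0] insert zero g = cong (λ w → g w + 0) G[0]
sumPerms-pivotWord G G[0] insert (suc k) g = begin
  sumMap (perms (upTo (suc (suc k)))) (g ∘ G)
    ≡⟨ sumPerms-upTo-suc (suc k) (g ∘ G) ⟩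
  sumMap Ps (λ a → sumMap (insertAll 0 (map suc a)) (g ∘ G))
    ≡⟨ cong sum (map-cong-local (All.map (λ {a} → insert g a) (perms-upTo-lengths (suc k)))) ⟩
  sumMap Ps (λ a → g (replicate (suc k) ℓ) + sumInserting μ g (G a))
    ≡⟨ sumMap-+ Ps (λ _ → g (replicate (suc k) ℓ)) (sumInserting μ g ∘ G) ⟩
  sumMap Ps (λ _ → g (replicate (suc k) ℓ)) + sumMap Ps (sumInserting μ g ∘ G)
    ≡⟨ cong₂ _+_ (trans (sumPerms-const (upTo (suc k)) _) (cong (λ n → n ! * g (replicate (suc k) ℓ)) (length-upTo (suc k))))
                 (sumPerms-pivotWord G G[0] insert k (sumInserting μ g)) ⟩
  suc k ! * g (replicate (suc k) ℓ) + sumWords k (λ w → weightNoσ 0 0 w * sumInserting μ g w)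
    ≡⟨ sumWords-weightNoσ-suc k g ⟩
  sumWords (suc k) (λ w → weightNoσ 0 0 w * g w) ∎
  where
  open ≡-Reasoning
  Ps : List (List ℕ)
  Ps = perms (upTo (suc k))

sumPerms-wordOf : ∀ m (g : List Letter → ℕ) →
  sumMap (perms (upTo (suc (suc m)))) (g ∘ wordOf) ≡ 2 * sumWords m (λ w → weight 0 0 0 w * g w)
sumPerms-wordOf zero g = solve 1 (λ x → x :+ (x :+ con 0) := con 2 :* (con 1 :* x)) refl (g [])
sumPerms-wordOf (suc m) g = begin
  sumMap (perms (upTo (suc (suc (suc m))))) (g ∘ wordOf)
    ≡⟨ sumPerms-upTo-suc (suc (suc m)) (g ∘ wordOf) ⟩
  sumMap Ps (λ a → sumMap (insertAll 0 (map suc a)) (g ∘ wordOf))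
    ≡⟨ cong sum (map-cong-local (All.map (λ {a} → wordOf-insert g a) (perms-upTo-lengths (suc (suc m))))) ⟩
  sumMap Ps (λ a → g (lastPivotWord a) + (sumInserting σ g (wordOf a) + g (firstPivotWord a)))
    ≡⟨ trans (sumMap-+ Ps (g ∘ lastPivotWord) _) (cong (sumMap Ps (g ∘ lastPivotWord) +_) (sumMap-+ Ps (sumInserting σ g ∘ wordOf) (g ∘ firstPivotWord))) ⟩
  sumMap Ps (g ∘ lastPivotWord) + (sumMap Ps (sumInserting σ g ∘ wordOf) + sumMap Ps (g ∘ firstPivotWord))
    ≡⟨ cong₂ _+_ (sumPerms-pivotWord lastPivotWord refl lastPivotWord-insert (suc m) g)
                 (cong₂ _+_ (sumPerms-wordOf m (sumInserting σ g)) (sumPerms-pivotWord firstPivotWord refl firstPivotWord-insert (suc m) g)) ⟩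
  Z + (2 * X + Z)
    ≡⟨ solve 2 (λ Z X → Z :+ (con 2 :* X :+ Z) := con 2 :* (Z :+ X)) refl Z X ⟩
  2 * (Z + X)
    ≡⟨ cong (2 *_) (sumWords-weight-suc m g) ⟩
  2 * sumWords (suc m) (λ w → weight 0 0 0 w * g w) ∎
  where
  open ≡-Reasoning
  Ps : List (List ℕ)
  Ps = perms (upTo (suc (suc m)))
  Z X : ℕ
  Z = sumWords (suc m) (λ w → weightNoσ 0 0 w * g w)
  X = sumWords m (λ w → weight 0 0 0 w * sumInserting σ g w)

-- Optimality of Count

mass : ℕ → ℕ → ℕ → ℕ → ℕ
mass k a m c = sumWords k (weight a m c)

mass-swap : ∀ k a m c → mass k a m c ≡ mass k c m a
mass-swap zero a m c = solve 3 (λ x y z → x :* y :* z := z :* y :* x) refl (a !) (m !) (c !)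
mass-swap (suc k) a m c =
  trans (cong₂ _+_ (mass-swap k (suc a) m c) (cong₂ _+_ (mass-swap k a (suc m) c) (mass-swap k a m (suc c))))
        (solve 3 (λ x y z → x :+ (y :+ z) := z :+ (y :+ x)) refl (mass k c m (suc a)) (mass k c (suc m) a) (mass k (suc c) m a))

-- Having seen no more λ's than σ's, the next letter is at most as likely to be λ as σ.
mass-ℓ≤σ : ∀ k a m c → c ≤ a → mass k a m (suc c) ≤ mass k (suc a) m c
mass-ℓ≤σ zero a m c c≤a = begin
  a ! * m ! * (suc c * c !)   ≡⟨ solve 4 (λ s x y z → x :* y :* (s :* z) := s :* (x :* y :* z)) refl (suc c) (a !) (m !) (c !) ⟩
  suc c * (a ! * m ! * c !)   ≤⟨ *-monoˡ-≤ (a ! * m ! * c !) (s≤s c≤a) ⟩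
  suc a * (a ! * m ! * c !)   ≡⟨ solve 4 (λ s x y z → s :* (x :* y :* z) := s :* x :* y :* z) refl (suc a) (a !) (m !) (c !) ⟩
  suc a * a ! * m ! * c !     ∎
  where open ≤-Reasoning
mass-ℓ≤σ (suc k) a m c c≤a = begin
  mass k (suc a) m (suc c) + (mass k a (suc m) (suc c) + mass k a m (suc (suc c)))
    ≤⟨ +-monoʳ-≤ (mass k (suc a) m (suc c)) (+-mono-≤ (mass-ℓ≤σ k a (suc m) c c≤a) twoSteps) ⟩
  mass k (suc a) m (suc c) + (mass k (suc a) (suc m) c + mass k (suc (suc a)) m c)
    ≡⟨ solve 3 (λ x y z → x :+ (y :+ z) := z :+ (y :+ x)) refl (mass k (suc a) m (suc c)) (mass k (suc a) (suc m) c) (mass k (suc (suc a)) m c) ⟩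
  mass k (suc (suc a)) m c + (mass k (suc a) (suc m) c + mass k (suc a) m (suc c)) ∎
  where
  open ≤-Reasoning
  twoSteps : mass k a m (suc (suc c)) ≤ mass k (suc (suc a)) m c
  twoSteps with m≤n⇒m<n∨m≡n c≤a
  ... | inj₁ c<a = ≤-trans (mass-ℓ≤σ k a m (suc c) c<a) (mass-ℓ≤σ k (suc a) m c (m≤n⇒m≤1+n c≤a))
  ... | inj₂ refl = ≤-reflexive (mass-swap k c m (suc (suc c)))

-- The cost of comparing first with v in the next step, where M x is the weight of the next letter being x.
missCost : Pivot → (Letter → ℕ) → ℕ
missCost P M = M ℓ
missCost Q M = M σ

sumLetters-stepCost : ∀ v (M : Letter → ℕ) → sumLetters (λ x → stepCost v x * M x) ≡ missCost v M
sumLetters-stepCost P M = +-identityʳ (M ℓ)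
sumLetters-stepCost Q M = trans (+-identityʳ _) (+-identityʳ (M σ))

countChoice-optimal : ∀ k a m c v →
  missCost (if c ≤ᵇ a then P else Q) (λ x → sumWords k (λ w → weight a m c (x ∷ w))) ≤ missCost v (λ x → sumWords k (λ w → weight a m c (x ∷ w)))
countChoice-optimal k a m c v with c ≤ᵇ a in eq
countChoice-optimal k a m c P | true = ≤-refl
countChoice-optimal k a m c Q | true = mass-ℓ≤σ k a m c (≤ᵇ⇒≤ c a (subst T (sym eq) tt))
countChoice-optimal k a m c P | false =
  subst₂ _≤_ (mass-swap k c m (suc a)) (mass-swap k (suc c) m a) (mass-ℓ≤σ k c m a (<⇒≤ (≰⇒> λ c≤a → subst T eq (≤⇒≤ᵇ c≤a))))
countChoice-optimal k a m c Q | false = ≤-refl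

sumWords-addCmpFrom : ∀ k f pre (W : List Letter → ℕ) →
  sumWords (suc k) (λ w → W w * addCmpFrom f pre w) ≡
  missCost (f pre) (λ x → sumWords k (λ w → W (x ∷ w))) + sumLetters (λ x → sumWords k (λ w → W (x ∷ w) * addCmpFrom f (pre ++ [ x ]) w))
sumWords-addCmpFrom k f pre W =
  trans (sumLetters-cong first)
  (trans (sumLetters-+ (λ x → stepCost (f pre) x * M x) rest)
         (cong (_+ sumLetters rest) (sumLetters-stepCost (f pre) M)))
  where
  M rest : Letter → ℕ
  M x = sumWords k (λ w → W (x ∷ w))
  rest x = sumWords k (λ w → W (x ∷ w) * addCmpFrom f (pre ++ [ x ]) w)
  first : ∀ x → sumWords k (λ w → W (x ∷ w) * (stepCost (f pre) x + addCmpFrom f (pre ++ [ x ]) w)) ≡ stepCost (f pre) x * M x + rest x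
  first x = trans (sumWords-distribˡ k (λ w → W (x ∷ w)) (λ _ → stepCost (f pre) x) (λ w → addCmpFrom f (pre ++ [ x ]) w))
                  (cong (_+ rest x) (trans (sumWords-cong k (λ w → *-comm (W (x ∷ w)) _)) (sumWords-* k (stepCost (f pre) x) (λ w → W (x ∷ w)))))

count-σ-++ : ∀ xs ys → count-σ (xs ++ ys) ≡ count-σ xs + count-σ ys
count-σ-++ [] ys = refl
count-σ-++ (x ∷ xs) ys = trans (cong (_ +_) (count-σ-++ xs ys)) (sym (+-assoc (if isσ x then 1 else 0) (count-σ xs) (count-σ ys)))

count-ℓ-++ : ∀ xs ys → count-ℓ (xs ++ ys) ≡ count-ℓ xs + count-ℓ ys
count-ℓ-++ [] ys = refl
count-ℓ-++ (x ∷ xs) ys = trans (cong (_ +_) (count-ℓ-++ xs ys)) (sym (+-assoc (if isℓ x then 1 else 0) (count-ℓ xs) (count-ℓ ys)))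

countStrategy-optimal : ∀ k f pre a m c → count-σ pre ≡ a → count-ℓ pre ≡ c →
  sumWords k (λ w → weight a m c w * addCmpFrom countStrategy pre w) ≤ sumWords k (λ w → weight a m c w * addCmpFrom f pre w)
countStrategy-optimal zero f pre a m c _ _ = ≤-refl
countStrategy-optimal (suc k) f pre a m c refl refl = begin
  sumWords (suc k) (λ w → W w * addCmpFrom countStrategy pre w)
    ≡⟨ sumWords-addCmpFrom k countStrategy pre W ⟩
  missCost (countStrategy pre) M + sumLetters (rest countStrategy)
    ≤⟨ +-mono-≤ (countChoice-optimal k a m c (f pre)) (sumLetters-mono-≤ next) ⟩
  missCost (f pre) M + sumLetters (rest f)
    ≡⟨ sumWords-addCmpFrom k f pre W ⟨
  sumWords (suc k) (λ w → W w * addCmpFrom f pre w) ∎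
  where
  open ≤-Reasoning
  W : List Letter → ℕ
  W = weight a m c
  M : Letter → ℕ
  M x = sumWords k (λ w → W (x ∷ w))
  rest : Strategy → Letter → ℕ
  rest g x = sumWords k (λ w → W (x ∷ w) * addCmpFrom g (pre ++ [ x ]) w)
  next : ∀ x → rest countStrategy x ≤ rest f x
  next σ = countStrategy-optimal k f (pre ++ [ σ ]) _ m _
    (trans (count-σ-++ pre [ σ ]) (+-comm _ 1)) (trans (count-ℓ-++ pre [ σ ]) (+-identityʳ _))
  next μ = countStrategy-optimal k f (pre ++ [ μ ]) _ _ _
    (trans (count-σ-++ pre [ μ ]) (+-identityʳ _)) (trans (count-ℓ-++ pre [ μ ]) (+-identityʳ _))
  next ℓ = countStrategy-optimal k f (pre ++ [ ℓ ]) _ m _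
    (trans (count-σ-++ pre [ ℓ ]) (+-identityʳ _)) (trans (count-ℓ-++ pre [ ℓ ]) (+-comm _ 1))

proposition15p1 : (n : ℕ) → 2 ≤ n → (f : Strategy) →
    totalAddCmp n countStrategy ≤ totalAddCmp n f
proposition15p1 (suc (suc m)) (s≤s (s≤s z≤n)) f = begin
  totalAddCmp (suc (suc m)) countStrategy                    ≡⟨ sumPerms-wordOf m (addCmp countStrategy) ⟩
  2 * sumWords m (λ w → weight 0 0 0 w * addCmp countStrategy w) ≤⟨ *-monoʳ-≤ 2 (countStrategy-optimal m f [] 0 0 0 refl refl) ⟩
  2 * sumWords m (λ w → weight 0 0 0 w * addCmp f w)             ≡⟨ sumPerms-wordOf m (addCmp f) ⟨
  totalAddCmp (suc (suc m)) f                                 ∎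
  where open ≤-Reasoning
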